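{- For every integer $n \geq 1$ we have $s(n) \geq \sqrt{\frac{3n+7}{5}}$.
   Context: Let $(a(n))_{n\ge 0}$ be the Rudin-Shapiro sequence, defined by $a(0)=1$, $a(2n)=a(n)$, $a(2n+1)=(-1)^n a(n)$ for $n\ge 0$. Let $s(n)=\sum_{0\le i\le n} a(i)$. -}

module Defs where

open import Data.Nat using (ℕ; zero; suc; _/_; _%_)
open import Data.Integer using (ℤ; +_; -_; _*_; _+_; _^_)

sign : ℕ → ℤ
sign m = (- (+ 1)) ^ m

-- Rudin-Shapiro recursion with a fuel argument (fuel ≥ n suffices since n/2 < n for n ≥ 1):
--   a(0) = 1, a(2m) = a(m), a(2m+1) = (-1)^m a(m).
rsFuel : ℕ → ℕ → ℤ
rsFuel _ zero = + 1
rsFuel zero (suc _) = + 1   -- unreachable when fuel ≥ n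
rsFuel (suc k) (suc n) with suc n % 2
... | zero = rsFuel k (suc n / 2)
... | suc _ = sign (suc n / 2) * rsFuel k (suc n / 2)

a : ℕ → ℤ
a n = rsFuel n n

s : ℕ → ℤ
s zero = a zero
s (suc n) = s n + a (suc n)

{-# OPTIONS --safe #-}
-- Write S(m) = a(0) + … + a(m − 1), so that s(n) = S(n + 1). For m = 4k + r with 0 ≤ r < 4 one
-- has S(m) = 2 S(k) + c, where c and the pair ((−1)^m, a(m)) depend only on r and on the pair
-- ((−1)^k, a(k)). To each of the four possible pairs we attach a lower bound x₀ and a quadratic
-- certificate 5x² + βx − 3m ≥ e for x = S(m). The identity
--   Q′(2x + c, 4k + r) = 4 Q(x, k) + (20c + 2β′ − 4β) x + Q′(c, r)
-- for Q(x, m) = 5x² + βx − 3m turns the propagation of these bounds from k to 4k + r into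
-- finitely many integer inequalities, checked by evaluation, as are the cases 2 ≤ m < 8.
-- Since every β is ≤ 0, finally 5 S(m)² ≥ e − βx₀ + 3m ≥ 3m + 4.
module Submission where

open import Defs
open import Data.Nat using (ℕ; _≥_)
open import Data.Integer using (+_; _*_; _+_; _≤_)
open import Data.Product using (_×_)

open import Agda.Builtin.FromNat
open import Agda.Builtin.FromNeg
open import Data.Unit using (tt)
open import Data.Fin using (Fin; zero; suc; toℕ)
open import Data.Nat as ℕ using (zero; suc; _/_; _%_; z≤n; s≤s)
import Data.Nat.Literals as ℕLit
import Data.Nat.Properties as ℕₚ
open import Data.Nat.DivMod
open import Data.Nat.Induction using (<-rec)
open import Data.Integer as ℤ using (ℤ; -_; _-_; _^_; nonNegative)
import Data.Integer.Literals as ℤLit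
import Data.Integer.Properties as ℤₚ
open import Data.Integer.Tactic.RingSolver using (solve-∀)
open import Data.Product using (_,_)
open import Data.Sign using (Sign)
open import Relation.Nullary.Decidable using (True; toWitness)
open import Relation.Binary.PropositionalEquality

instance
  ℕ-number : Number ℕ
  ℕ-number = ℕLit.number
  ℤ-number : Number ℤ
  ℤ-number = ℤLit.number
  ℤ-negative : Negative ℤ
  ℤ-negative = ℤLit.negative

byEvaluation : ∀ {x y} {x≤?y : True (x ℤ.≤? y)} → x ≤ y
byEvaluation {x≤?y = x≤?y} = toWitness x≤?y

[1+n]/2≤k : ∀ {n k} → n ℕ.≤ k → suc n / 2 ℕ.≤ k
[1+n]/2≤k {n} n≤k = ℕₚ.≤-trans (ℕₚ.≤-pred (m/n<m (suc n) 2 (s≤s (s≤s z≤n)))) n≤k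

rsFuel-irrelevant : ∀ {k k′} n → n ℕ.≤ k → n ℕ.≤ k′ → rsFuel k n ≡ rsFuel k′ n
rsFuel-irrelevant zero _ _ = refl
rsFuel-irrelevant (suc n) (s≤s n≤k) (s≤s n≤k′) with suc n % 2
... | zero  = rsFuel-irrelevant (suc n / 2) ([1+n]/2≤k n≤k) ([1+n]/2≤k n≤k′)
... | suc _ = cong (sign (suc n / 2) *_) (rsFuel-irrelevant (suc n / 2) ([1+n]/2≤k n≤k) ([1+n]/2≤k n≤k′))

rsFuel-suc-even : ∀ k m → suc m % 2 ≡ 0 → rsFuel (suc k) (suc m) ≡ rsFuel k (suc m / 2)
rsFuel-suc-even k m eq with suc m % 2 | eq
... | .zero | refl = refl

rsFuel-suc-odd : ∀ k m → suc m % 2 ≡ 1 → rsFuel (suc k) (suc m) ≡ sign (suc m / 2) * rsFuel k (suc m / 2)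
rsFuel-suc-odd k m eq with suc m % 2 | eq
... | .1 | refl = refl

a[n*2]≡a[n] : ∀ n → a (n ℕ.* 2) ≡ a n
a[n*2]≡a[n] zero    = refl
a[n*2]≡a[n] (suc n) = begin
  rsFuel (suc n ℕ.* 2) (suc n ℕ.* 2)      ≡⟨ rsFuel-suc-even (suc (n ℕ.* 2)) (suc (n ℕ.* 2)) (m*n%n≡0 (suc n) 2) ⟩
  rsFuel (suc (n ℕ.* 2)) (suc n ℕ.* 2 / 2) ≡⟨ cong (rsFuel _) (m*n/n≡m (suc n) 2) ⟩
  rsFuel (suc (n ℕ.* 2)) (suc n)           ≡⟨ rsFuel-irrelevant _ (s≤s (ℕₚ.m≤m*n n 2)) ℕₚ.≤-refl ⟩
  a (suc n)                                ∎
  where open ≡-Reasoning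

a[1+n*2]≡sign[n]*a[n] : ∀ n → a (suc (n ℕ.* 2)) ≡ sign n * a n
a[1+n*2]≡sign[n]*a[n] n = begin
  rsFuel (suc (n ℕ.* 2)) (suc (n ℕ.* 2))
    ≡⟨ rsFuel-suc-odd (n ℕ.* 2) (n ℕ.* 2) ([m+kn]%n≡m%n 1 n 2) ⟩
  sign (suc (n ℕ.* 2) / 2) * rsFuel (n ℕ.* 2) (suc (n ℕ.* 2) / 2)
    ≡⟨ cong (λ h → sign h * rsFuel (n ℕ.* 2) h) [1+n*2]/2≡n ⟩
  sign n * rsFuel (n ℕ.* 2) n
    ≡⟨ cong (sign n *_) (rsFuel-irrelevant _ (ℕₚ.m≤m*n n 2) ℕₚ.≤-refl) ⟩
  sign n * a n
    ∎
  where
  open ≡-Reasoning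
  [1+n*2]/2≡n : suc (n ℕ.* 2) / 2 ≡ n
  [1+n*2]/2≡n = trans (+-distrib-/ 1 (n ℕ.* 2) (subst (λ t → 1 ℕ.+ t ℕ.< 2) (sym (m*n%n≡0 n 2)) ℕₚ.≤-refl))
                      (m*n/n≡m n 2)

data IsUnit : ℤ → Set where
  plus-one  : IsUnit 1
  minus-one : IsUnit -1

*-isUnit : ∀ {x y} → IsUnit x → IsUnit y → IsUnit (x * y)
*-isUnit plus-one  plus-one  = plus-one
*-isUnit plus-one  minus-one = minus-one
*-isUnit minus-one plus-one  = minus-one
*-isUnit minus-one minus-one = plus-one

sign-isUnit : ∀ m → IsUnit (sign m)
sign-isUnit zero    = plus-one
sign-isUnit (suc m) = *-isUnit minus-one (sign-isUnit m)

rsFuel-isUnit : ∀ k n → IsUnit (rsFuel k n)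
rsFuel-isUnit _       zero    = plus-one
rsFuel-isUnit zero    (suc n) = plus-one
rsFuel-isUnit (suc k) (suc n) with suc n % 2
... | zero  = rsFuel-isUnit k (suc n / 2)
... | suc _ = *-isUnit (sign-isUnit (suc n / 2)) (rsFuel-isUnit k (suc n / 2))

a-isUnit : ∀ n → IsUnit (a n)
a-isUnit n = rsFuel-isUnit n n

sign[m+n*2]≡sign[m] : ∀ m n → sign (m ℕ.+ n ℕ.* 2) ≡ sign m
sign[m+n*2]≡sign[m] m n = begin
  sign (m ℕ.+ n ℕ.* 2)    ≡⟨ ℤₚ.^-distribˡ-+-* -1 m (n ℕ.* 2) ⟩
  sign m * sign (n ℕ.* 2) ≡⟨ cong (sign m *_) sign[n*2]≡1 ⟩
  sign m * 1              ≡⟨ ℤₚ.*-identityʳ (sign m) ⟩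
  sign m                  ∎
  where
  open ≡-Reasoning
  sign[n*2]≡1 : sign (n ℕ.* 2) ≡ 1
  sign[n*2]≡1 = begin
    -1 ^ (n ℕ.* 2) ≡⟨ cong (-1 ^_) (ℕₚ.*-comm n 2) ⟩
    -1 ^ (2 ℕ.* n) ≡⟨ ℤₚ.^-*-assoc -1 2 n ⟨
    (-1 ^ 2) ^ n   ≡⟨ ℤₚ.^-zeroˡ n ⟩
    1              ∎

k*4≡k*2*2 : ∀ k → k ℕ.* 4 ≡ k ℕ.* 2 ℕ.* 2
k*4≡k*2*2 k = sym (ℕₚ.*-assoc k 2 2)

sign[r+k*4]≡sign[r] : ∀ r k → sign (r ℕ.+ k ℕ.* 4) ≡ sign r
sign[r+k*4]≡sign[r] r k = trans (cong (λ t → sign (r ℕ.+ t)) (k*4≡k*2*2 k)) (sign[m+n*2]≡sign[m] r (k ℕ.* 2))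

-- a (r + 4k) and a (4k) + … + a (4k + r − 1) as functions of σ = sign k and α = a k
aDigit prefixDigit : Fin 4 → ℤ → ℤ → ℤ
aDigit zero                   σ α = α
aDigit (suc zero)             σ α = α
aDigit (suc (suc zero))       σ α = σ * α
aDigit (suc (suc (suc zero))) σ α = - (σ * α)
prefixDigit zero                   σ α = 0
prefixDigit (suc zero)             σ α = α
prefixDigit (suc (suc zero))       σ α = α + α
prefixDigit (suc (suc (suc zero))) σ α = α + α + σ * α

a[r+k*4]≡aDigit : ∀ r k → a (toℕ r ℕ.+ k ℕ.* 4) ≡ aDigit r (sign k) (a k)
a[r+k*4]≡aDigit r k = trans (cong (λ t → a (toℕ r ℕ.+ t)) (k*4≡k*2*2 k)) (digit r)
  where
  open ≡-Reasoning
  digit : ∀ r → a (toℕ r ℕ.+ k ℕ.* 2 ℕ.* 2) ≡ aDigit r (sign k) (a k)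
  digit zero = trans (a[n*2]≡a[n] (k ℕ.* 2)) (a[n*2]≡a[n] k)
  digit (suc zero) = begin
    a (suc (k ℕ.* 2 ℕ.* 2))      ≡⟨ a[1+n*2]≡sign[n]*a[n] (k ℕ.* 2) ⟩
    sign (k ℕ.* 2) * a (k ℕ.* 2) ≡⟨ cong₂ _*_ (sign[m+n*2]≡sign[m] 0 k) (a[n*2]≡a[n] k) ⟩
    1 * a k                      ≡⟨ ℤₚ.*-identityˡ (a k) ⟩
    a k                          ∎
  digit (suc (suc zero)) = trans (a[n*2]≡a[n] (suc (k ℕ.* 2))) (a[1+n*2]≡sign[n]*a[n] k)
  digit (suc (suc (suc zero))) = begin
    a (suc (suc (k ℕ.* 2) ℕ.* 2))                  ≡⟨ a[1+n*2]≡sign[n]*a[n] (suc (k ℕ.* 2)) ⟩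
    sign (suc (k ℕ.* 2)) * a (suc (k ℕ.* 2))       ≡⟨ cong₂ _*_ (sign[m+n*2]≡sign[m] 1 k) (a[1+n*2]≡sign[n]*a[n] k) ⟩
    -1 * (sign k * a k)                            ≡⟨ ℤₚ.-1*i≡-i (sign k * a k) ⟩
    - (sign k * a k)                               ∎

prefixSum : ℕ → ℤ
prefixSum zero    = 0
prefixSum (suc m) = prefixSum m + a m

s≡prefixSum : ∀ n → s n ≡ prefixSum (suc n)
s≡prefixSum zero    = refl
s≡prefixSum (suc n) = cong (_+ a (suc n)) (s≡prefixSum n)

prefixSum[k*4]≡2*prefixSum[k] : ∀ k → prefixSum (k ℕ.* 4) ≡ 2 * prefixSum k
prefixSum[r+k*4]≡prefixDigit : ∀ r k → prefixSum (toℕ r ℕ.+ k ℕ.* 4) ≡ 2 * prefixSum k + prefixDigit r (sign k) (a k)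

prefixSum[k*4]≡2*prefixSum[k] zero    = refl
prefixSum[k*4]≡2*prefixSum[k] (suc k) = begin
  prefixSum (3 ℕ.+ k ℕ.* 4) + a (3 ℕ.+ k ℕ.* 4)
    ≡⟨ cong₂ _+_ (prefixSum[r+k*4]≡prefixDigit three k) (a[r+k*4]≡aDigit three k) ⟩
  2 * prefixSum k + (a k + a k + sign k * a k) + - (sign k * a k)
    ≡⟨ identity (prefixSum k) (sign k) (a k) ⟩
  2 * (prefixSum k + a k)
    ∎
  where
  open ≡-Reasoning
  three : Fin 4
  three = suc (suc (suc zero))
  identity : ∀ x σ α → 2 * x + (α + α + σ * α) + - (σ * α) ≡ 2 * (x + α)
  identity = solve-∀

prefixSum[r+k*4]≡prefixDigit zero k =
  trans (prefixSum[k*4]≡2*prefixSum[k] k) (sym (ℤₚ.+-identityʳ (2 * prefixSum k)))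
prefixSum[r+k*4]≡prefixDigit (suc zero) k =
  cong₂ _+_ (prefixSum[k*4]≡2*prefixSum[k] k) (a[r+k*4]≡aDigit zero k)
prefixSum[r+k*4]≡prefixDigit (suc (suc zero)) k =
  trans (cong₂ _+_ (cong₂ _+_ (prefixSum[k*4]≡2*prefixSum[k] k) (a[r+k*4]≡aDigit zero k))
                   (a[r+k*4]≡aDigit (suc zero) k))
        (ℤₚ.+-assoc (2 * prefixSum k) (a k) (a k))
prefixSum[r+k*4]≡prefixDigit (suc (suc (suc zero))) k =
  trans (cong₂ _+_ (cong₂ _+_ (cong₂ _+_ (prefixSum[k*4]≡2*prefixSum[k] k) (a[r+k*4]≡aDigit zero k))
                              (a[r+k*4]≡aDigit (suc zero) k))
                   (a[r+k*4]≡aDigit (suc (suc zero)) k))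
        (identity (2 * prefixSum k) (sign k) (a k))
  where
  identity : ∀ x σ α → x + α + α + σ * α ≡ x + (α + α + σ * α)
  identity = solve-∀

record QuadBound : Set where
  constructor quadBound
  field
    lower slope const : ℤ
open QuadBound

quadForm : ℤ → ℤ → ℤ → ℤ
quadForm β x m = 5 * (x * x) + β * x - 3 * m

Satisfies : QuadBound → ℤ → ℕ → Set
Satisfies b x m = lower b ≤ x × const b ≤ quadForm (slope b) x (+ m)

linearGain : QuadBound → QuadBound → ℤ → ℤ
linearGain b b′ c = 20 * c + 2 * slope b′ - 4 * slope b

Propagates : QuadBound → QuadBound → ℤ → ℕ → Set
Propagates b b′ c r =
    lower b′ ≤ 2 * lower b + c
  × 0 ≤ linearGain b b′ c
  × const b′ ≤ 4 * const b + linearGain b b′ c * lower b + quadForm (slope b′) c (+ r)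

quadForm-rescale : ∀ β β′ x c r m →
  quadForm β′ (2 * x + c) (+ (r ℕ.+ m ℕ.* 4))
    ≡ 4 * quadForm β x (+ m) + (20 * c + 2 * β′ - 4 * β) * x + quadForm β′ c (+ r)
quadForm-rescale β β′ x c r m = begin
  quadForm β′ (2 * x + c) (+ (r ℕ.+ m ℕ.* 4))
    ≡⟨ cong (quadForm β′ (2 * x + c)) (trans (ℤₚ.pos-+ r (m ℕ.* 4)) (cong (_+_ (+ r)) (ℤₚ.pos-* m 4))) ⟩
  quadForm β′ (2 * x + c) (+ r + + m * 4)
    ≡⟨ identity β β′ x c (+ r) (+ m) ⟩
  4 * quadForm β x (+ m) + (20 * c + 2 * β′ - 4 * β) * x + quadForm β′ c (+ r)
    ∎
  where
  open ≡-Reasoning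
  identity : ∀ β β′ x c r m →
    5 * ((2 * x + c) * (2 * x + c)) + β′ * (2 * x + c) - 3 * (r + m * 4)
      ≡ 4 * (5 * (x * x) + β * x - 3 * m) + (20 * c + 2 * β′ - 4 * β) * x + (5 * (c * c) + β′ * c - 3 * r)
  identity = solve-∀

propagate : ∀ {b b′ c r x m} → Propagates b b′ c r → Satisfies b x m →
            Satisfies b′ (2 * x + c) (r ℕ.+ m ℕ.* 4)
propagate {b} {b′} {c} {r} {x} {m} (x₀′≤2x₀+c , 0≤gain , e′≤) (x₀≤x , e≤Q) =
  ℤₚ.≤-trans x₀′≤2x₀+c (ℤₚ.+-monoˡ-≤ c (ℤₚ.*-monoˡ-≤-nonNeg 2 x₀≤x)) ,
  (begin
    const b′
      ≤⟨ e′≤ ⟩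
    4 * const b + gain * lower b + quadForm (slope b′) c (+ r)
      ≤⟨ ℤₚ.+-monoˡ-≤ _ (ℤₚ.+-mono-≤ (ℤₚ.*-monoˡ-≤-nonNeg 4 e≤Q)
                                     (ℤₚ.*-monoˡ-≤-nonNeg gain ⦃ nonNegative 0≤gain ⦄ x₀≤x)) ⟩
    4 * quadForm (slope b) x (+ m) + gain * x + quadForm (slope b′) c (+ r)
      ≡⟨ quadForm-rescale (slope b) (slope b′) x c r m ⟨
    quadForm (slope b′) (2 * x + c) (+ (r ℕ.+ m ℕ.* 4))
      ∎)
  where
  open ℤₚ.≤-Reasoning
  gain = linearGain b b′ c

Concludes : QuadBound → Set
Concludes b = 0 ≤ lower b × 0 ≤ - slope b × 4 ≤ const b + - slope b * lower b

conclude : ∀ {b x} n → Concludes b → Satisfies b x (suc n) → 0 ≤ x × 3 * + n + 7 ≤ 5 * (x * x)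
conclude {b} {x} n (0≤x₀ , 0≤-β , 4≤e-βx₀) (x₀≤x , e≤Q) =
  ℤₚ.≤-trans 0≤x₀ x₀≤x ,
  (begin
    3 * + n + 7
      ≡⟨ shift (+ n) ⟩
    4 + 3 * (1 + + n)
      ≤⟨ ℤₚ.+-monoˡ-≤ _ 4≤e-βx₀ ⟩
    const b + - β * lower b + 3 * + suc n
      ≤⟨ ℤₚ.+-monoˡ-≤ _ (ℤₚ.+-mono-≤ e≤Q (ℤₚ.*-monoˡ-≤-nonNeg (- β) ⦃ nonNegative 0≤-β ⦄ x₀≤x)) ⟩
    quadForm β x (+ suc n) + - β * x + 3 * + suc n
      ≡⟨ complete β x (+ suc n) ⟩
    5 * (x * x)
      ∎)
  where
  open ℤₚ.≤-Reasoning
  β = slope b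
  shift : ∀ y → 3 * y + 7 ≡ 4 + 3 * (1 + y)
  shift = solve-∀
  complete : ∀ β x m → 5 * (x * x) + β * x - 3 * m + - β * x + 3 * m ≡ 5 * (x * x)
  complete = solve-∀

bound : Sign → Sign → QuadBound
bound Sign.+ Sign.+ = quadBound 2 -12 -16
bound Sign.+ Sign.- = quadBound 4 -20 -18
bound Sign.- Sign.+ = quadBound 3 -10 -6
bound Sign.- Sign.- = quadBound 3 -22 -30

-- σ = sign m and α = a m are ±1, so ℤ.sign records the parity of m and the value of a m.
boundAt : ℤ → ℤ → QuadBound
boundAt σ α = bound (ℤ.sign σ) (ℤ.sign α)

boundAt-propagates : ∀ r {σ α} → IsUnit σ → IsUnit α →
  Propagates (boundAt σ α) (boundAt (sign (toℕ r)) (aDigit r σ α)) (prefixDigit r σ α) (toℕ r)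
boundAt-propagates zero                   plus-one  plus-one  = byEvaluation , byEvaluation , byEvaluation
boundAt-propagates zero                   plus-one  minus-one = byEvaluation , byEvaluation , byEvaluation
boundAt-propagates zero                   minus-one plus-one  = byEvaluation , byEvaluation , byEvaluation
boundAt-propagates zero                   minus-one minus-one = byEvaluation , byEvaluation , byEvaluation
boundAt-propagates (suc zero)             plus-one  plus-one  = byEvaluation , byEvaluation , byEvaluation
boundAt-propagates (suc zero)             plus-one  minus-one = byEvaluation , byEvaluation , byEvaluation
boundAt-propagates (suc zero)             minus-one plus-one  = byEvaluation , byEvaluation , byEvaluation
boundAt-propagates (suc zero)             minus-one minus-one = byEvaluation , byEvaluation , byEvaluation
boundAt-propagates (suc (suc zero))       plus-one  plus-one  = byEvaluation , byEvaluation , byEvaluation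
boundAt-propagates (suc (suc zero))       plus-one  minus-one = byEvaluation , byEvaluation , byEvaluation
boundAt-propagates (suc (suc zero))       minus-one plus-one  = byEvaluation , byEvaluation , byEvaluation
boundAt-propagates (suc (suc zero))       minus-one minus-one = byEvaluation , byEvaluation , byEvaluation
boundAt-propagates (suc (suc (suc zero))) plus-one  plus-one  = byEvaluation , byEvaluation , byEvaluation
boundAt-propagates (suc (suc (suc zero))) plus-one  minus-one = byEvaluation , byEvaluation , byEvaluation
boundAt-propagates (suc (suc (suc zero))) minus-one plus-one  = byEvaluation , byEvaluation , byEvaluation
boundAt-propagates (suc (suc (suc zero))) minus-one minus-one = byEvaluation , byEvaluation , byEvaluation

boundAt-concludes : ∀ {σ α} → IsUnit σ → IsUnit α → Concludes (boundAt σ α)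
boundAt-concludes plus-one  plus-one  = byEvaluation , byEvaluation , byEvaluation
boundAt-concludes plus-one  minus-one = byEvaluation , byEvaluation , byEvaluation
boundAt-concludes minus-one plus-one  = byEvaluation , byEvaluation , byEvaluation
boundAt-concludes minus-one minus-one = byEvaluation , byEvaluation , byEvaluation

Invariant : ℕ → Set
Invariant m = Satisfies (boundAt (sign m) (a m)) (prefixSum m) m

invariant-base4 : ∀ r k → Invariant k → Invariant (toℕ r ℕ.+ k ℕ.* 4)
invariant-base4 r k inv
  rewrite sign[r+k*4]≡sign[r] (toℕ r) k | a[r+k*4]≡aDigit r k | prefixSum[r+k*4]≡prefixDigit r k
  = propagate {r = toℕ r} {m = k} (boundAt-propagates r (sign-isUnit k) (a-isUnit k)) inv

invariant : ∀ m → 2 ℕ.≤ m → Invariant m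
invariant = <-rec (λ m → 2 ℕ.≤ m → Invariant m) step
  where
  step : ∀ m → (∀ {j} → j ℕ.< m → 2 ℕ.≤ j → Invariant j) → 2 ℕ.≤ m → Invariant m
  step 0 _ ()
  step 1 _ (s≤s ())
  step 2 _ _ = byEvaluation , byEvaluation
  step 3 _ _ = byEvaluation , byEvaluation
  step 4 _ _ = byEvaluation , byEvaluation
  step 5 _ _ = byEvaluation , byEvaluation
  step 6 _ _ = byEvaluation , byEvaluation
  step 7 _ _ = byEvaluation , byEvaluation
  step m@(suc (suc (suc (suc (suc (suc (suc (suc n)))))))) invariant< _ =
    subst Invariant (sym property)
      (invariant-base4 remainder quotient
        (invariant< (m/n<m m 4 (s≤s (s≤s z≤n))) (/-monoˡ-≤ 4 (ℕₚ.m≤m+n 8 n))))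
    where open DivMod (m divMod 4)

corollary21 : (n : ℕ) → n ≥ 1 →
    (+ 0 ≤ s n) × (+ 3 * + n + + 7 ≤ + 5 * (s n * s n))
corollary21 n n≥1 rewrite s≡prefixSum n =
  conclude n (boundAt-concludes (sign-isUnit (suc n)) (a-isUnit (suc n))) (invariant (suc n) (s≤s n≥1))
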